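{- Let $G$ be a finite directed graph without self-loops and multi-edges (unweighted, or weighted with positive edge weights). Let $r\in V(G)$ and assume $\mathcal{RV}(r)\neq\emptyset$. Let $T\ge 1$ be an integer. Choose vertices $v_1,\dots,v_T$ independently and uniformly at random from $\mathcal{RV}(r)$, and set $$bc=\sum_{t=1}^{T}\frac{\delta_{v_t\bullet}(r)\cdot|\mathcal{RV}(r)|}{T}.$$ Then $\mathbb{E}[bc]=BC(r)$.
   Context: For $u,v\in V(G)$, a shortest path from $u$ to $v$ is a directed path of minimum length, where length is the number of edges in the unweighted case and the sum of the edge weights in the weighted case. $\sigma_{st}$ is the number of shortest paths from $s$ to $t$, and $\sigma_{st}(v)$ is the number of these passing through $v$. The betweenness centrality is $BC(v)=\sum_{s,t\in V(G)\setminus\{v\}}\sigma_{st}(v)/\sigma_{st}$, and for $s\ne v$ the dependency score is $\delta_{s\bullet}(v)=\sum_{t\in V(G)\setminus\{v,s\}}\sigma_{st}(v)/\sigma_{st}$; in both sums, terms with $\sigma_{st}=0$ are $0$. $\mathcal{RV}(r)$ is the set of vertices $v\neq r$ such that there is a directed path from $r$ to $v$ in the reverse graph of $G$. Equivalently, it is the set of vertices $v\ne r$ from which there is a directed path to $r$ in $G$.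
   Formalization: The edge weights are positive rationals. -}

module Defs where

open import Data.Nat as ℕ using (ℕ; zero; suc; NonZero)
open import Data.Bool using (Bool; true; false; _∧_; _∨_; not; if_then_else_)
open import Data.Fin using (Fin; _≟_)
open import Data.List using (List; []; _∷_; map; concatMap; filterᵇ; length; allFin; foldr)
open import Data.Bool.ListAction using (all; any)
open import Data.Vec as Vec using (Vec)
open import Data.Integer using (+_)
open import Data.Rational using (ℚ; 0ℚ; _+_; _*_; _/_; _<_; _≤ᵇ_)
open import Data.Product using (_×_)
open import Relation.Nullary.Decidable using (⌊_⌋)
open import Relation.Binary.PropositionalEquality using (_≡_)

-- A finite directed graph on vertex set Fin n, given by an adjacency
-- relation E (so there are no multi-edges) and edge weights w.
-- The unweighted case is the special case w u v = 1.
record Graph : Set where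
  field
    n : ℕ
    E : Fin n → Fin n → Bool
    w : Fin n → Fin n → ℚ

ValidGraph : Graph → Set
ValidGraph G = (∀ v → E v v ≡ false) × (∀ u v → E u v ≡ true → 0ℚ < w u v)
  where open Graph G

sumℚ : List ℚ → ℚ
sumℚ = foldr _+_ 0ℚ

listsUpTo : {A : Set} → List A → ℕ → List (List A)
listsUpTo xs zero = [] ∷ []
listsUpTo xs (suc m) = [] ∷ concatMap (λ v → map (v ∷_) (listsUpTo xs m)) xs

tuples : {A : Set} → List A → (k : ℕ) → List (Vec A k)
tuples xs zero = Vec.[] ∷ []
tuples xs (suc k) = concatMap (λ v → map (v Vec.∷_) (tuples xs k)) xs

-- mean of a list of rationals (0 for the empty list)
mean : List ℚ → ℚ
mean xs with length xs
... | zero = 0ℚ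
... | suc m = sumℚ xs * (+ 1 / suc m)

-- a / b, with value 0 when b = 0
ratio : ℕ → ℕ → ℚ
ratio a zero = 0ℚ
ratio a (suc b) = + a / suc b

module _ (G : Graph) where
  open Graph G

  eqV : Fin n → Fin n → Bool
  eqV u v = ⌊ u ≟ v ⌋

  edgesOK : List (Fin n) → Bool
  edgesOK [] = true
  edgesOK (u ∷ []) = true
  edgesOK (u ∷ v ∷ p) = E u v ∧ edgesOK (v ∷ p)

  distinct : List (Fin n) → Bool
  distinct [] = true
  distinct (u ∷ p) = not (any (eqV u) p) ∧ distinct p

  headIs : Fin n → List (Fin n) → Bool
  headIs s [] = false
  headIs s (u ∷ _) = eqV s u

  lastIs : Fin n → List (Fin n) → Bool
  lastIs t [] = false
  lastIs t (u ∷ []) = eqV t u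
  lastIs t (u ∷ v ∷ p) = lastIs t (v ∷ p)

  isPath : Fin n → Fin n → List (Fin n) → Bool
  isPath s t p = headIs s p ∧ lastIs t p ∧ edgesOK p ∧ distinct p

  pathLength : List (Fin n) → ℚ
  pathLength [] = 0ℚ
  pathLength (u ∷ []) = 0ℚ
  pathLength (u ∷ v ∷ p) = w u v + pathLength (v ∷ p)

  -- every directed path has at most n vertices
  candidates : List (List (Fin n))
  candidates = listsUpTo (allFin n) n

  isShortest : Fin n → Fin n → List (Fin n) → Bool
  isShortest s t p = isPath s t p ∧
    all (λ q → not (isPath s t q) ∨ (pathLength p ≤ᵇ pathLength q)) candidates

  σ : Fin n → Fin n → ℕ
  σ s t = length (filterᵇ (isShortest s t) candidates)

  σthrough : Fin n → Fin n → Fin n → ℕ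
  σthrough s t v = length (filterᵇ (λ p → isShortest s t p ∧ any (eqV v) p) candidates)

  BC : Fin n → ℚ
  BC v = sumℚ (concatMap (λ s → map (λ t →
           if not (eqV s v) ∧ not (eqV t v)
           then ratio (σthrough s t v) (σ s t) else 0ℚ) (allFin n)) (allFin n))

  δ : Fin n → Fin n → ℚ
  δ s v = sumℚ (map (λ t →
           if not (eqV t v) ∧ not (eqV t s)
           then ratio (σthrough s t v) (σ s t) else 0ℚ) (allFin n))

  RV : Fin n → List (Fin n)
  RV r = filterᵇ (λ v → not (eqV v r) ∧ any (isPath v r) candidates) (allFin n)

  bcEstimate : Fin n → (T : ℕ) → .{{_ : NonZero T}} → Vec (Fin n) T → ℚ
  bcEstimate r T vs = sumℚ (Vec.toList (Vec.map (λ v → δ v r * (+ length (RV r) / T)) vs))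

  -- E[bc] when v_1..v_T are i.i.d. uniform on RV(r): the average over all T-tuples of RV(r)
  expectedBC : Fin n → (T : ℕ) → .{{_ : NonZero T}} → ℚ
  expectedBC r T = mean (map (bcEstimate r T) (tuples (RV r) T))

-- Averaging over all T-tuples of RV(r) is sampling with replacement: over the |RV(r)|^T
-- tuples every coordinate takes each value in RV(r) equally often, so the mean of the
-- estimator is Σ_{s ∈ RV(r)} δ_{s•}(r). That sum is BC(r). A shortest s–t path through r
-- has an s–r path as a prefix, so σ_st(r) = 0 for every source s ∉ RV(r) ∪ {r}; and the
-- term t = s, which δ_{s•}(r) omits but BC(r) includes, vanishes because the only path
-- from s to itself is the trivial one.

module Submission where

open import Defs
open import Data.Nat using (ℕ; NonZero)
open import Data.Fin using (Fin)
open import Data.List using ([])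
open import Relation.Binary.PropositionalEquality using (_≡_; _≢_)

open import Algebra.Bundles using (CommutativeRing)
import Algebra.Properties.Semiring.Mult as SemiringMult
open import Data.Bool using (Bool; true; false; not; T; _∧_; if_then_else_)
open import Data.Bool.ListAction using (any)
open import Data.Bool.Properties using (T-∧; T-∨; T-not-≡)
open import Data.Empty using (⊥-elim)
open import Data.Fin using (_≟_)
import Data.Integer as ℤ
import Data.Integer.Properties as ℤP
open import Data.List using (List; _∷_; _++_; map; concatMap; filterᵇ; length; allFin)
open import Data.List.Membership.Propositional using (_∈_; lose)
open import Data.List.Membership.Propositional.Properties using (∈-concatMap⁺; ∈-concatMap⁻; ∈-map⁺; ∈-map⁻; ∈-allFin)
open import Data.List.Properties using (length-++; length-map; map-∘; map-cong; map-concatMap; filter-none)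
open import Data.List.Relation.Unary.All as All using ()
open import Data.List.Relation.Unary.Any using (here; there; satisfied)
open import Data.List.Relation.Unary.Any.Properties using (any⁺)
import Data.Nat as ℕ
open import Data.Nat using (zero; suc; 2+; _≤_; z≤n; s≤s; _^_)
import Data.Nat.Properties as ℕP
open import Data.Product using (_×_; _,_; proj₁)
open import Data.Sum using (inj₁; inj₂)
open import Data.Unit using (tt)
open import Data.Rational using (ℚ; 0ℚ; 1ℚ; _+_; _*_; _/_; toℚᵘ)
import Data.Rational.Properties as ℚP
import Data.Rational.Unnormalised as ℚᵘ
import Data.Rational.Unnormalised.Properties as ℚᵘP
open import Data.Vec as Vec using (Vec)
open import Function using (_∘_; Equivalence)
open import Level using (0ℓ)
open import Relation.Binary.PropositionalEquality using (refl; sym; trans; cong; cong₂; subst; module ≡-Reasoning)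
open import Relation.Nullary using (¬_; yes; no)
open import Relation.Nullary.Decidable using (T?; toWitness; fromWitness; dec⇒maybe)
open import Tactic.RingSolver using (solve-∀)
open import Tactic.RingSolver.Core.AlmostCommutativeRing using (AlmostCommutativeRing; fromCommutativeRing)

open Equivalence using (to; from)
open ≡-Reasoning

ℚ-ring : AlmostCommutativeRing 0ℓ 0ℓ
ℚ-ring = fromCommutativeRing ℚP.+-*-commutativeRing (λ x → dec⇒maybe (0ℚ ℚP.≟ x))

module ℚMult = SemiringMult (CommutativeRing.semiring ℚP.+-*-commutativeRing)

fromℕ : ℕ → ℚ
fromℕ n = n ℚMult.× 1ℚ

fromℕ-* : ∀ m n → fromℕ (m ℕ.* n) ≡ fromℕ m * fromℕ n
fromℕ-* = ℚMult.×1-homo-*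

toℚᵘ-fromℕ : ∀ n → toℚᵘ (fromℕ n) ℚᵘ.≃ ℚᵘ.mkℚᵘ (ℤ.+ n) 0
toℚᵘ-fromℕ zero    = ℚᵘP.≃-refl
toℚᵘ-fromℕ (suc n) = ℚᵘP.≃-trans (ℚP.toℚᵘ-homo-+ 1ℚ (fromℕ n))
  (ℚᵘP.≃-trans (ℚᵘP.+-congʳ ℚᵘ.1ℚᵘ (toℚᵘ-fromℕ n))
               (ℚᵘ.*≡* cross-multiplied))
  where
  cross-multiplied : (ℤ.+ 1 ℤ.* ℤ.+ 1 ℤ.+ ℤ.+ n ℤ.* ℤ.+ 1) ℤ.* ℤ.+ 1 ≡ ℤ.+ suc n ℤ.* (ℤ.+ 1 ℤ.* ℤ.+ 1)
  cross-multiplied = trans (ℤP.*-identityʳ _)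
    (trans (cong (λ i → ℤ.+ 1 ℤ.+ i) (ℤP.*-identityʳ (ℤ.+ n))) (sym (ℤP.*-identityʳ _)))

fromℕ-*-/ : ∀ k d .{{_ : NonZero d}} → fromℕ d * (ℤ.+ k / d) ≡ fromℕ k
fromℕ-*-/ k d@(suc d-1) = ℚP.toℚᵘ-injective
  (ℚᵘP.≃-trans (ℚP.toℚᵘ-homo-* (fromℕ d) (ℤ.+ k / d))
  (ℚᵘP.≃-trans (ℚᵘP.*-cong (toℚᵘ-fromℕ d) (ℚP.toℚᵘ-fromℚᵘ (ℚᵘ.mkℚᵘ (ℤ.+ k) d-1)))
  (ℚᵘP.≃-trans (ℚᵘ.*≡* cross-multiplied) (ℚᵘP.≃-sym (toℚᵘ-fromℕ k)))))
  where
  cross-multiplied : (ℤ.+ d ℤ.* ℤ.+ k) ℤ.* ℤ.+ 1 ≡ ℤ.+ k ℤ.* ℤ.+ (1 ℕ.* d)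
  cross-multiplied = trans (ℤP.*-identityʳ _)
    (trans (ℤP.*-comm (ℤ.+ d) (ℤ.+ k)) (cong (λ m → ℤ.+ k ℤ.* ℤ.+ m) (sym (ℕP.*-identityˡ d))))

sumℚ-++ : ∀ xs ys → sumℚ (xs ++ ys) ≡ sumℚ xs + sumℚ ys
sumℚ-++ []       ys = sym (ℚP.+-identityˡ (sumℚ ys))
sumℚ-++ (x ∷ xs) ys = trans (cong (x +_) (sumℚ-++ xs ys)) (sym (ℚP.+-assoc x (sumℚ xs) (sumℚ ys)))

sumℚ-concatMap : ∀ {A : Set} (f : A → List ℚ) xs → sumℚ (concatMap f xs) ≡ sumℚ (map (sumℚ ∘ f) xs)
sumℚ-concatMap f []       = refl
sumℚ-concatMap f (x ∷ xs) = trans (sumℚ-++ (f x) (concatMap f xs)) (cong (sumℚ (f x) +_) (sumℚ-concatMap f xs))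

sumℚ-map-cong : ∀ {A : Set} {f g : A → ℚ} → (∀ x → f x ≡ g x) → ∀ xs → sumℚ (map f xs) ≡ sumℚ (map g xs)
sumℚ-map-cong f≗g xs = cong sumℚ (map-cong f≗g xs)

sumℚ-map-0 : ∀ {A : Set} {f : A → ℚ} → (∀ x → f x ≡ 0ℚ) → ∀ xs → sumℚ (map f xs) ≡ 0ℚ
sumℚ-map-0 f≗0 []       = refl
sumℚ-map-0 f≗0 (x ∷ xs) = cong₂ _+_ (f≗0 x) (sumℚ-map-0 f≗0 xs)

sumℚ-map-+ : ∀ {A : Set} (f g : A → ℚ) xs →
             sumℚ (map (λ x → f x + g x) xs) ≡ sumℚ (map f xs) + sumℚ (map g xs)
sumℚ-map-+ f g []       = refl
sumℚ-map-+ f g (x ∷ xs) =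
  trans (cong (f x + g x +_) (sumℚ-map-+ f g xs)) (interchange (f x) (g x) (sumℚ (map f xs)) (sumℚ (map g xs)))
  where
  interchange : ∀ a b c d → (a + b) + (c + d) ≡ (a + c) + (b + d)
  interchange = solve-∀ ℚ-ring

sumℚ-map-*ˡ : ∀ {A : Set} (c : ℚ) (f : A → ℚ) xs → sumℚ (map (λ x → c * f x) xs) ≡ c * sumℚ (map f xs)
sumℚ-map-*ˡ c f []       = sym (ℚP.*-zeroʳ c)
sumℚ-map-*ˡ c f (x ∷ xs) =
  trans (cong (c * f x +_) (sumℚ-map-*ˡ c f xs)) (sym (ℚP.*-distribˡ-+ c (f x) (sumℚ (map f xs))))

sumℚ-map-*ʳ : ∀ {A : Set} (f : A → ℚ) (c : ℚ) xs → sumℚ (map (λ x → f x * c) xs) ≡ sumℚ (map f xs) * c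
sumℚ-map-*ʳ f c xs = trans (sumℚ-map-cong (λ x → ℚP.*-comm (f x) c) xs)
                    (trans (sumℚ-map-*ˡ c f xs) (ℚP.*-comm c (sumℚ (map f xs))))

sumℚ-map-const : ∀ {A : Set} (c : ℚ) (xs : List A) → sumℚ (map (λ _ → c) xs) ≡ fromℕ (length xs) * c
sumℚ-map-const c []       = sym (ℚP.*-zeroˡ c)
sumℚ-map-const c (x ∷ xs) = trans (cong (c +_) (sumℚ-map-const c xs))
  (trans (cong (_+ fromℕ (length xs) * c) (sym (ℚP.*-identityˡ c))) (sym (ℚP.*-distribʳ-+ c 1ℚ (fromℕ (length xs)))))

sumℚ-filterᵇ : ∀ {A : Set} (P : A → Bool) (f : A → ℚ) xs →
               sumℚ (map f (filterᵇ P xs)) ≡ sumℚ (map (λ x → if P x then f x else 0ℚ) xs)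
sumℚ-filterᵇ P f []       = refl
sumℚ-filterᵇ P f (x ∷ xs) with P x
... | true  = cong (f x +_) (sumℚ-filterᵇ P f xs)
... | false = trans (sumℚ-filterᵇ P f xs) (sym (ℚP.+-identityˡ _))

mean≡sum*1/length : ∀ xs d .{{_ : NonZero d}} → length xs ≡ d → mean xs ≡ sumℚ xs * (ℤ.+ 1 / d)
mean≡sum*1/length []       d eq   = ⊥-elim (ℕ.≢-nonZero⁻¹ d (sym eq))
mean≡sum*1/length (x ∷ xs) _ refl = refl

sumᵛ : ∀ {X : Set} {k} → (X → ℚ) → Vec X k → ℚ
sumᵛ F vs = sumℚ (Vec.toList (Vec.map F vs))

length-tuples : ∀ {X : Set} (xs : List X) k → length (tuples xs k) ≡ length xs ^ k
length-tuples xs zero    = refl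
length-tuples xs (suc k) = count xs
  where
  count : ∀ ys → length (concatMap (λ v → map (v Vec.∷_) (tuples xs k)) ys) ≡ length ys ℕ.* length xs ^ k
  count []       = refl
  count (y ∷ ys) = trans (length-++ (map (y Vec.∷_) (tuples xs k)))
    (cong₂ ℕ._+_ (trans (length-map (y Vec.∷_) (tuples xs k)) (length-tuples xs k)) (count ys))

module _ {X : Set} (F : X → ℚ) (xs : List X) where

  sumᵛ-tuples-suc : ∀ k → sumℚ (map (sumᵛ F) (tuples xs (suc k)))
    ≡ fromℕ (length xs ^ k) * sumℚ (map F xs) + fromℕ (length xs) * sumℚ (map (sumᵛ F) (tuples xs k))
  sumᵛ-tuples-suc k = begin
    sumℚ (map (sumᵛ F) (concatMap (λ v → map (v Vec.∷_) ts) xs))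
      ≡⟨ cong sumℚ (map-concatMap (sumᵛ F) (λ v → map (v Vec.∷_) ts) xs) ⟩
    sumℚ (concatMap (λ v → map (sumᵛ F) (map (v Vec.∷_) ts)) xs)
      ≡⟨ sumℚ-concatMap (λ v → map (sumᵛ F) (map (v Vec.∷_) ts)) xs ⟩
    sumℚ (map (λ v → sumℚ (map (sumᵛ F) (map (v Vec.∷_) ts))) xs)
      ≡⟨ sumℚ-map-cong row xs ⟩
    sumℚ (map (λ v → N * F v + S) xs)
      ≡⟨ sumℚ-map-+ (λ v → N * F v) (λ _ → S) xs ⟩
    sumℚ (map (λ v → N * F v) xs) + sumℚ (map (λ _ → S) xs)
      ≡⟨ cong₂ _+_ (sumℚ-map-*ˡ N F xs) (sumℚ-map-const S xs) ⟩
    N * sumℚ (map F xs) + fromℕ (length xs) * S ∎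
    where
    ts : List (Vec X k)
    ts = tuples xs k
    N S : ℚ
    N = fromℕ (length xs ^ k)
    S = sumℚ (map (sumᵛ F) ts)

    row : ∀ v → sumℚ (map (sumᵛ F) (map (v Vec.∷_) ts)) ≡ N * F v + S
    row v = begin
      sumℚ (map (sumᵛ F) (map (v Vec.∷_) ts))       ≡⟨ cong sumℚ (sym (map-∘ ts)) ⟩
      sumℚ (map (λ ws → F v + sumᵛ F ws) ts)        ≡⟨ sumℚ-map-+ (λ _ → F v) (sumᵛ F) ts ⟩
      sumℚ (map (λ _ → F v) ts) + S                 ≡⟨ cong (_+ S) (sumℚ-map-const (F v) ts) ⟩
      fromℕ (length ts) * F v + S                   ≡⟨ cong (λ m → fromℕ m * F v + S) (length-tuples xs k) ⟩
      N * F v + S                                   ∎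

  sumᵛ-tuples : ∀ k → sumℚ (map (sumᵛ F) (tuples xs (suc k)))
    ≡ fromℕ (suc k) * fromℕ (length xs ^ k) * sumℚ (map F xs)
  sumᵛ-tuples zero = trans (sumᵛ-tuples-suc zero) (base (sumℚ (map F xs)) (fromℕ (length xs)))
    where
    base : ∀ s l → (1ℚ + 0ℚ) * s + l * (0ℚ + 0ℚ) ≡ (1ℚ + 0ℚ) * (1ℚ + 0ℚ) * s
    base = solve-∀ ℚ-ring
  sumᵛ-tuples (suc k) = begin
    sumℚ (map (sumᵛ F) (tuples xs (2+ k)))
      ≡⟨ sumᵛ-tuples-suc (suc k) ⟩
    fromℕ (L ℕ.* L ^ k) * s + fromℕ L * sumℚ (map (sumᵛ F) (tuples xs (suc k)))
      ≡⟨ cong₂ (λ a b → a * s + fromℕ L * b) (fromℕ-* L (L ^ k)) (sumᵛ-tuples k) ⟩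
    fromℕ L * fromℕ (L ^ k) * s + fromℕ L * (fromℕ (suc k) * fromℕ (L ^ k) * s)
      ≡⟨ step (fromℕ L) (fromℕ (L ^ k)) (fromℕ (suc k)) s ⟩
    fromℕ (2+ k) * (fromℕ L * fromℕ (L ^ k)) * s
      ≡⟨ cong (λ a → fromℕ (2+ k) * a * s) (sym (fromℕ-* L (L ^ k))) ⟩
    fromℕ (2+ k) * fromℕ (L ^ suc k) * s ∎
    where
    L : ℕ
    L = length xs
    s : ℚ
    s = sumℚ (map F xs)
    step : ∀ l p c x → l * p * x + l * (c * p * x) ≡ (1ℚ + c) * (l * p) * x
    step = solve-∀ ℚ-ring

tuples-estimator-unbiased : ∀ {X : Set} (xs : List X) (Δ : X → ℚ) k .{{_ : NonZero k}} → xs ≢ [] →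
  mean (map (sumᵛ (λ v → Δ v * (ℤ.+ length xs / k))) (tuples xs k)) ≡ sumℚ (map Δ xs)
tuples-estimator-unbiased []                Δ k         xs≢[] = ⊥-elim (xs≢[] refl)
tuples-estimator-unbiased {X} xs@(_ ∷ _) Δ k@(suc j) _ = begin
  mean (map (sumᵛ F) (tuples xs k))
    ≡⟨ mean≡sum*1/length (map (sumᵛ F) (tuples xs k)) N
         (trans (length-map (sumᵛ F) (tuples xs k)) (length-tuples xs k)) ⟩
  sumℚ (map (sumᵛ F) (tuples xs k)) * (ℤ.+ 1 / N)
    ≡⟨ cong (_* (ℤ.+ 1 / N)) (sumᵛ-tuples F xs j) ⟩
  fromℕ k * fromℕ (L ^ j) * sumℚ (map F xs) * (ℤ.+ 1 / N)
    ≡⟨ cong (λ a → fromℕ k * fromℕ (L ^ j) * a * (ℤ.+ 1 / N)) (sumℚ-map-*ʳ Δ c xs) ⟩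
  fromℕ k * fromℕ (L ^ j) * (sumℚ (map Δ xs) * c) * (ℤ.+ 1 / N)
    ≡⟨ regroup (fromℕ k) (fromℕ (L ^ j)) (sumℚ (map Δ xs)) c (ℤ.+ 1 / N) ⟩
  fromℕ k * c * fromℕ (L ^ j) * (ℤ.+ 1 / N) * sumℚ (map Δ xs)
    ≡⟨ cong (λ a → a * fromℕ (L ^ j) * (ℤ.+ 1 / N) * sumℚ (map Δ xs)) (fromℕ-*-/ L k) ⟩
  fromℕ L * fromℕ (L ^ j) * (ℤ.+ 1 / N) * sumℚ (map Δ xs)
    ≡⟨ cong (λ a → a * (ℤ.+ 1 / N) * sumℚ (map Δ xs)) (sym (fromℕ-* L (L ^ j))) ⟩
  fromℕ N * (ℤ.+ 1 / N) * sumℚ (map Δ xs)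
    ≡⟨ cong (_* sumℚ (map Δ xs)) (fromℕ-*-/ 1 N) ⟩
  (1ℚ + 0ℚ) * sumℚ (map Δ xs)
    ≡⟨ unit (sumℚ (map Δ xs)) ⟩
  sumℚ (map Δ xs) ∎
  where
  L N : ℕ
  L = length xs
  N = L ^ k
  c : ℚ
  c = ℤ.+ L / k
  F : X → ℚ
  F v = Δ v * c
  instance
    N-nonZero : NonZero N
    N-nonZero = ℕP.m^n≢0 L k
  regroup : ∀ t p d c u → t * p * (d * c) * u ≡ t * c * p * u * d
  regroup = solve-∀ ℚ-ring
  unit : ∀ d → (1ℚ + 0ℚ) * d ≡ d
  unit = solve-∀ ℚ-ring

listsUpTo-length : ∀ {A : Set} (xs : List A) m {q} → q ∈ listsUpTo xs m → length q ≤ m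
listsUpTo-length xs zero    (here refl) = z≤n
listsUpTo-length xs (suc m) (here refl) = z≤n
listsUpTo-length xs (suc m) (there q∈)
  with a , q∈a∷ ← satisfied (∈-concatMap⁻ (λ v → map (v ∷_) (listsUpTo xs m)) {xs = xs} q∈)
  with q′ , q′∈ , refl ← ∈-map⁻ (a ∷_) q∈a∷
  = s≤s (listsUpTo-length xs m q′∈)

listsUpTo-complete : ∀ {A : Set} (xs : List A) m {q} → (∀ x → x ∈ xs) → length q ≤ m → q ∈ listsUpTo xs m
listsUpTo-complete xs zero    {[]}    _     _         = here refl
listsUpTo-complete xs (suc m) {[]}    _     _         = here refl
listsUpTo-complete xs (suc m) {v ∷ q} every (s≤s q≤m) = there (∈-concatMap⁺ (λ v → map (v ∷_) (listsUpTo xs m))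
  {xs = xs} (lose (every v) (∈-map⁺ (v ∷_) (listsUpTo-complete xs m every q≤m))))

ratio-0 : ∀ d → ratio 0 d ≡ 0ℚ
ratio-0 zero    = refl
ratio-0 (suc d) = ℚP.0/n≡0 (suc d)

module _ (G : Graph) where
  open Graph G

  isPath⁻ : ∀ {s t} p → T (isPath G s t p) →
            T (headIs G s p) × T (lastIs G t p) × T (edgesOK G p) × T (distinct G p)
  isPath⁻ p path = let (hd , path₁) = to T-∧ path; (l , path₂) = to T-∧ path₁ in hd , l , to T-∧ path₂

  isPath⁺ : ∀ {s t} p → T (headIs G s p) → T (lastIs G t p) → T (edgesOK G p) → T (distinct G p) →
            T (isPath G s t p)
  isPath⁺ p hd l ok d = from T-∧ (hd , from T-∧ (l , from T-∧ (ok , d)))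

  lastIs⇒any : ∀ t p → T (lastIs G t p) → T (any (eqV G t) p)
  lastIs⇒any t (u ∷ [])    l = from T-∨ (inj₁ l)
  lastIs⇒any t (u ∷ w ∷ p) l = from (T-∨ {eqV G t u}) (inj₂ (lastIs⇒any t (w ∷ p) l))

  isPath-loop⇒singleton : ∀ s p → T (isPath G s s p) → p ≡ s ∷ []
  isPath-loop⇒singleton s (u ∷ p) path with isPath⁻ (u ∷ p) path
  ... | s≟u , l , _ , d with refl ← toWitness {a? = s ≟ u} s≟u with p
  ...   | []    = refl
  ...   | w ∷ q = ⊥-elim (subst T (to T-not-≡ s∉w∷q) (lastIs⇒any s (w ∷ q) l))
    where
    s∉w∷q : T (not (any (eqV G s) (w ∷ q)))
    s∉w∷q = proj₁ (to T-∧ d)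

  takeUntil : Fin n → List (Fin n) → List (Fin n)
  takeUntil v []      = []
  takeUntil v (u ∷ p) = u ∷ (if eqV G v u then [] else takeUntil v p)

  takeUntil-length : ∀ v p → length (takeUntil v p) ≤ length p
  takeUntil-length v []      = z≤n
  takeUntil-length v (u ∷ p) with eqV G v u
  ... | true  = s≤s z≤n
  ... | false = s≤s (takeUntil-length v p)

  takeUntil-headIs : ∀ s v p → T (headIs G s p) → T (headIs G s (takeUntil v p))
  takeUntil-headIs s v (u ∷ p) hd = hd

  takeUntil-lastIs : ∀ v p → T (any (eqV G v) p) → T (lastIs G v (takeUntil v p))
  takeUntil-lastIs v (u ∷ p) v∈p with v ≟ u
  takeUntil-lastIs v (u ∷ p)     v∈p | yes v≡u = fromWitness v≡u
  takeUntil-lastIs v (u ∷ w ∷ p) v∈p | no _    = takeUntil-lastIs v (w ∷ p) v∈p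

  takeUntil-edgesOK : ∀ v p → T (edgesOK G p) → T (edgesOK G (takeUntil v p))
  takeUntil-edgesOK v []      _  = tt
  takeUntil-edgesOK v (u ∷ p) ok with eqV G v u
  takeUntil-edgesOK v (u ∷ p)     ok | true  = tt
  takeUntil-edgesOK v (u ∷ [])    ok | false = tt
  takeUntil-edgesOK v (u ∷ w ∷ p) ok | false =
    let (uw , ok′) = to T-∧ ok in from T-∧ (uw , takeUntil-edgesOK v (w ∷ p) ok′)

  takeUntil-none : ∀ f v p → T (not (any f p)) → T (not (any f (takeUntil v p)))
  takeUntil-none f v []      _    = tt
  takeUntil-none f v (u ∷ p) none with f u | eqV G v u
  ... | false | true  = tt
  ... | false | false = takeUntil-none f v p none

  takeUntil-distinct : ∀ v p → T (distinct G p) → T (distinct G (takeUntil v p))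
  takeUntil-distinct v []      _ = tt
  takeUntil-distinct v (u ∷ p) d with eqV G v u
  ... | true  = tt
  ... | false = let (u∉p , d′) = to T-∧ d in
                from T-∧ (takeUntil-none (eqV G u) v p u∉p , takeUntil-distinct v p d′)

  takeUntil-isPath : ∀ s t v p → T (isPath G s t p) → T (any (eqV G v) p) → T (isPath G s v (takeUntil v p))
  takeUntil-isPath s t v p path v∈p =
    let (hd , _ , ok , d) = isPath⁻ p path in
    isPath⁺ (takeUntil v p) (takeUntil-headIs s v p hd) (takeUntil-lastIs v p v∈p)
            (takeUntil-edgesOK v p ok) (takeUntil-distinct v p d)

  takeUntil-candidate : ∀ v {p} → p ∈ candidates G → takeUntil v p ∈ candidates G
  takeUntil-candidate v {p} p∈ = listsUpTo-complete (allFin n) n ∈-allFin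
    (ℕP.≤-trans (takeUntil-length v p) (listsUpTo-length (allFin n) n p∈))

  pairDependency : Fin n → Fin n → Fin n → ℚ
  pairDependency s t v = ratio (σthrough G s t v) (σ G s t)

  pairDependency-avoided : ∀ s t v →
    (∀ {p} → p ∈ candidates G → T (isPath G s t p) → ¬ T (any (eqV G v) p)) → pairDependency s t v ≡ 0ℚ
  pairDependency-avoided s t v avoided =
    trans (cong (λ k → ratio (length k) (σ G s t)) (filter-none (T? ∘ shortestThrough) (All.tabulate excluded)))
          (ratio-0 (σ G s t))
    where
    shortestThrough : List (Fin n) → Bool
    shortestThrough p = isShortest G s t p ∧ any (eqV G v) p
    excluded : ∀ {p} → p ∈ candidates G → ¬ T (shortestThrough p)
    excluded p∈ h = let (shortest , v∈p) = to T-∧ h in avoided p∈ (proj₁ (to T-∧ shortest)) v∈p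

  pairDependency-unreachable : ∀ s t v → ¬ T (any (isPath G s v) (candidates G)) → pairDependency s t v ≡ 0ℚ
  pairDependency-unreachable s t v unreachable = pairDependency-avoided s t v λ {p} p∈ path v∈p →
    unreachable (any⁺ (isPath G s v) (lose (takeUntil-candidate v p∈) (takeUntil-isPath s t v p path v∈p)))

  pairDependency-loop : ∀ s v → s ≢ v → pairDependency s s v ≡ 0ℚ
  pairDependency-loop s v s≢v = pairDependency-avoided s s v avoided
    where
    avoided : ∀ {p} → p ∈ candidates G → T (isPath G s s p) → ¬ T (any (eqV G v) p)
    avoided {p} _ path v∈p with refl ← isPath-loop⇒singleton s p path with v ≟ s
    ... | yes v≡s = s≢v (sym v≡s)
    ... | no _    = v∈p

  RV-row≡BC-row : ∀ r s →
    (if not (eqV G s r) ∧ any (isPath G s r) (candidates G) then δ G s r else 0ℚ)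
    ≡ sumℚ (map (λ t → if not (eqV G s r) ∧ not (eqV G t r) then pairDependency s t r else 0ℚ) (allFin n))
  RV-row≡BC-row r s with s ≟ r | any (isPath G s r) (candidates G) in reach
  ... | yes _   | _     = sym (sumℚ-map-0 (λ _ → refl) (allFin n))
  ... | no s≢r  | true  = sumℚ-map-cong skip-self (allFin n)
    where
    skip-self : ∀ t → (if not (eqV G t r) ∧ not (eqV G t s) then pairDependency s t r else 0ℚ)
                    ≡ (if not (eqV G t r) then pairDependency s t r else 0ℚ)
    skip-self t with eqV G t r | t ≟ s
    ... | true  | _        = refl
    ... | false | no _     = refl
    ... | false | yes refl = sym (pairDependency-loop s r s≢r)
  ... | no _    | false = sym (sumℚ-map-0 vanish (allFin n))
    where
    vanish : ∀ t → (if not (eqV G t r) then pairDependency s t r else 0ℚ) ≡ 0ℚ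
    vanish t with eqV G t r
    ... | true  = refl
    ... | false = pairDependency-unreachable s t r (subst T reach)

  sumℚ-δ-RV≡BC : ∀ r → sumℚ (map (λ s → δ G s r) (RV G r)) ≡ BC G r
  sumℚ-δ-RV≡BC r = begin
    sumℚ (map (λ s → δ G s r) (RV G r))
      ≡⟨ sumℚ-filterᵇ (λ s → not (eqV G s r) ∧ any (isPath G s r) (candidates G)) (λ s → δ G s r) (allFin n) ⟩
    sumℚ (map (λ s → if not (eqV G s r) ∧ any (isPath G s r) (candidates G) then δ G s r else 0ℚ) (allFin n))
      ≡⟨ sumℚ-map-cong (RV-row≡BC-row r) (allFin n) ⟩
    sumℚ (map (sumℚ ∘ row) (allFin n))
      ≡⟨ sym (sumℚ-concatMap row (allFin n)) ⟩
    BC G r ∎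
    where
    row : Fin n → List ℚ
    row s = map (λ t → if not (eqV G s r) ∧ not (eqV G t r) then pairDependency s t r else 0ℚ) (allFin n)

proposition3 : (G : Graph) → ValidGraph G → (r : Fin (Graph.n G)) →
    RV G r ≢ [] → (T : ℕ) → .{{_ : NonZero T}} →
    expectedBC G r T ≡ BC G r
proposition3 G _ r RV≢[] T = begin
  expectedBC G r T                     ≡⟨ tuples-estimator-unbiased (RV G r) (λ s → δ G s r) T RV≢[] ⟩
  sumℚ (map (λ s → δ G s r) (RV G r))  ≡⟨ sumℚ-δ-RV≡BC G r ⟩
  BC G r                               ∎
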